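{- For any finite simple undirected graph $G=(V,E)$ and any threshold function $t:V\to\mathbb{N}_0$, the set $S$ output by Algorithm TSS on $(G,t)$ is a target set for $G$ (with thresholds $t$).
   Context: For a graph $H$ and vertex $v$, $\Gamma_H(v)$ is the neighborhood of $v$ and $d_H(v)=|\Gamma_H(v)|$; $\Gamma(v),d(v)$ refer to $G$. $\mathbb{N}_0=\{0,1,2,\ldots\}$. Activation process: for a graph $H=(W,F)$ with thresholds $\tau:W\to\mathbb{N}_0$ and $S\subseteq W$, set $\mathrm{Active}_H[S,0]=S$ and for $\ell\ge1$, $\mathrm{Active}_H[S,\ell]=\mathrm{Active}_H[S,\ell-1]\cup\{u\in W: |\Gamma_H(u)\cap \mathrm{Active}_H[S,\ell-1]|\ge \tau(u)\}$. $S$ is a target set for $H$ if $\mathrm{Active}_H[S,\lambda]=W$ for some $\lambda\ge0$. Algorithm TSS on input $(G,t)$: set $S=\emptyset$, $U=V$, and for each $v\in V$ set $\delta(v)=d(v)$, $k(v)=t(v)$, $N(v)=\Gamma(v)$. While $U\neq\emptyset$: (Case 1) if some $v\in U$ has $k(v)=0$, select such a $v$ and for each $u\in N(v)$ set $k(u)=\max(k(u)-1,0)$; (Case 2) otherwise, if some $v\in U$ has $\delta(v)<k(v)$, select such a $v$, set $S=S\cup\{v\}$, and for each $u\in N(v)$ set $k(u)=k(u)-1$; (Case 3) otherwise select $v\in\arg\max_{u\in U} \frac{k(u)}{\delta(u)(\delta(u)+1)}$. In every case, then, for each $u\in N(v)$ set $\delta(u)=\delta(u)-1$ and $N(u)=N(u)\setminus\{v\}$,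 and set $U=U\setminus\{v\}$. When $U=\emptyset$, output $S$. (When several vertices qualify for selection, the algorithm picks one of them; the choice rule is not specified.) -}

module Defs where

open import Data.Nat using (ℕ; zero; suc; _∸_; _*_; _≤_; _<_; _≤?_)
open import Data.Fin using (Fin)
open import Data.Fin.Subset using (Subset; _∈_; _∉_; _∩_; _∪_; _─_; ⁅_⁆; ∣_∣; ⊤; ⊥)
open import Data.Fin.Subset.Properties using (_∈?_)
open import Data.Vec using (tabulate)
open import Data.Bool using (if_then_else_)
open import Data.Product using (∃)
open import Relation.Nullary using (does; ¬_)
open import Relation.Binary.PropositionalEquality using (_≡_; _≢_)

record Graph (n : ℕ) : Set where
  field
    Γ      : Fin n → Subset n
    sym    : ∀ {u v} → v ∈ Γ u → u ∈ Γ v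
    irrefl : ∀ {v} → v ∉ Γ v
open Graph public

deg : ∀ {n} → Graph n → Fin n → ℕ
deg G v = ∣ Γ G v ∣

Active : ∀ {n} → Graph n → (Fin n → ℕ) → Subset n → ℕ → Subset n
Active G τ S zero = S
Active G τ S (suc ℓ) =
  Active G τ S ℓ ∪ tabulate (λ u → does (τ u ≤? ∣ Γ G u ∩ Active G τ S ℓ ∣))

IsTargetSet : ∀ {n} → Graph n → (Fin n → ℕ) → Subset n → Set
IsTargetSet G τ S = ∃ λ λ' → Active G τ S λ' ≡ ⊤

record State (n : ℕ) : Set where
  constructor state
  field
    S : Subset n
    U : Subset n
    δ : Fin n → ℕ
    k : Fin n → ℕ
    N : Fin n → Subset n
open State public

initState : ∀ {n} → Graph n → (Fin n → ℕ) → State n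
initState G t = state ⊥ ⊤ (deg G) t (Γ G)

-- The update common to all three cases, after vertex v has been selected;
-- k' and S' are the already-updated values of k and S for the case at hand.
finish : ∀ {n} → State n → Fin n → (Fin n → ℕ) → Subset n → State n
finish st v k' S' =
  state S' (U st ─ ⁅ v ⁆)
        (λ u → if does (u ∈? N st v) then δ st u ∸ 1 else δ st u)
        k'
        (λ u → if does (u ∈? N st v) then N st u ─ ⁅ v ⁆ else N st u)

-- One iteration of the while loop (any admissible choice of v).
data Step {n : ℕ} (st : State n) : State n → Set where
  case1 : (v : Fin n) → v ∈ U st → k st v ≡ 0 →
          Step st (finish st v
                     (λ u → if does (u ∈? N st v) then k st u ∸ 1 else k st u)
                     (S st))
  case2 : (v : Fin n) → v ∈ U st →
          (∀ u → u ∈ U st → k st u ≢ 0) →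
          δ st v < k st v →
          Step st (finish st v
                     (λ u → if does (u ∈? N st v) then k st u ∸ 1 else k st u)
                     (S st ∪ ⁅ v ⁆))
  -- argmax of k/(δ(δ+1)), written by cross-multiplication (all
  -- denominators δ(δ+1) are positive here, since 1 ≤ k ≤ δ on U).
  case3 : (v : Fin n) → v ∈ U st →
          (∀ u → u ∈ U st → k st u ≢ 0) →
          (∀ u → u ∈ U st → ¬ (δ st u < k st u)) →
          (∀ u → u ∈ U st →
             k st u * (δ st v * suc (δ st v)) ≤ k st v * (δ st u * suc (δ st u))) →
          Step st (finish st v (k st) (S st))

data Run {n : ℕ} : State n → Subset n → Set where
  done : ∀ {st} → U st ≡ ⊥ → Run st (S st)
  step : ∀ {st st' out} → Step st st' → Run st' out → Run st out

module Submission where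

-- Follow a run of the algorithm backwards.  A vertex removed in Case 1
-- or Case 2 is "settled": it is in S (Case 2), or the neighbours settled
-- before it already meet its threshold (Case 1).  A vertex v removed in
-- Case 3 is "deferred": its counter k(v) ≤ δ(v) is covered by neighbours
-- still present, which are activated later in the backward argument.

open import Defs hiding (sym)
open import Data.Nat using (ℕ; zero; suc; _+_; _∸_; _≤_; _<_; _≤?_)
open import Data.Nat.Properties
  using ( ≤-trans; ≤-reflexive; m≤m+n; m≤n+m∸n; ≮⇒≥; +-identityʳ; +-suc; +-comm
        ; +-monoˡ-≤; +-monoʳ-≤; ∸-monoˡ-≤; module ≤-Reasoning)
open import Data.Fin using (Fin) renaming (_≟_ to _≟ᶠ_)
open import Data.Fin.Subset
open import Data.Fin.Subset.Properties
open import Data.Vec using (_∷_; []; here; there; lookup; tabulate)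
open import Data.Vec.Properties using (lookup∘tabulate; lookup⇒[]=)
open import Data.Bool using (Bool; true; false; if_then_else_)
open import Data.Product using (∃; _×_; _,_)
open import Data.Sum using (inj₁; inj₂)
open import Function using (_∘_; id)
open import Relation.Nullary using (¬_; does; yes; no)
open import Relation.Nullary.Decidable using (dec-true)
open import Relation.Binary.PropositionalEquality
  using (_≡_; _≢_; refl; sym; trans; cong; subst)

private
  variable
    m : ℕ

∣p∪q∣+∣p∩q∣≡∣p∣+∣q∣ : (p q : Subset m) → ∣ p ∪ q ∣ + ∣ p ∩ q ∣ ≡ ∣ p ∣ + ∣ q ∣
∣p∪q∣+∣p∩q∣≡∣p∣+∣q∣ [] [] = refl
∣p∪q∣+∣p∩q∣≡∣p∣+∣q∣ (inside ∷ p) (inside ∷ q) =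
  cong suc (trans (+-suc ∣ p ∪ q ∣ ∣ p ∩ q ∣)
                  (trans (cong suc (∣p∪q∣+∣p∩q∣≡∣p∣+∣q∣ p q)) (sym (+-suc ∣ p ∣ ∣ q ∣))))
∣p∪q∣+∣p∩q∣≡∣p∣+∣q∣ (inside ∷ p) (outside ∷ q) = cong suc (∣p∪q∣+∣p∩q∣≡∣p∣+∣q∣ p q)
∣p∪q∣+∣p∩q∣≡∣p∣+∣q∣ (outside ∷ p) (inside ∷ q) =
  trans (cong suc (∣p∪q∣+∣p∩q∣≡∣p∣+∣q∣ p q)) (sym (+-suc ∣ p ∣ ∣ q ∣))
∣p∪q∣+∣p∩q∣≡∣p∣+∣q∣ (outside ∷ p) (outside ∷ q) = ∣p∪q∣+∣p∩q∣≡∣p∣+∣q∣ p q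

∣p∪q∣≤∣p∣+∣q∣ : (p q : Subset m) → ∣ p ∪ q ∣ ≤ ∣ p ∣ + ∣ q ∣
∣p∪q∣≤∣p∣+∣q∣ p q =
  subst (∣ p ∪ q ∣ ≤_) (∣p∪q∣+∣p∩q∣≡∣p∣+∣q∣ p q) (m≤m+n ∣ p ∪ q ∣ ∣ p ∩ q ∣)

disjoint⇒∣p∪q∣≡∣p∣+∣q∣ : (p q : Subset m) → Empty (p ∩ q) → ∣ p ∪ q ∣ ≡ ∣ p ∣ + ∣ q ∣
disjoint⇒∣p∪q∣≡∣p∣+∣q∣ {m} p q p∩q-empty = begin
  ∣ p ∪ q ∣                ≡⟨ sym (+-identityʳ ∣ p ∪ q ∣) ⟩
  ∣ p ∪ q ∣ + 0            ≡⟨ cong (∣ p ∪ q ∣ +_) (sym (∣⊥∣≡0 m)) ⟩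
  ∣ p ∪ q ∣ + ∣ ⊥ {m} ∣    ≡⟨ cong (λ s → ∣ p ∪ q ∣ + ∣ s ∣) (sym (Empty-unique p∩q-empty)) ⟩
  ∣ p ∪ q ∣ + ∣ p ∩ q ∣    ≡⟨ ∣p∪q∣+∣p∩q∣≡∣p∣+∣q∣ p q ⟩
  ∣ p ∣ + ∣ q ∣            ∎
  where open Relation.Binary.PropositionalEquality.≡-Reasoning

∣r∩p∣≤1+∣r∩[p-x]∣ : (r p : Subset m) (x : Fin m) → ∣ r ∩ p ∣ ≤ suc ∣ r ∩ (p - x) ∣
∣r∩p∣≤1+∣r∩[p-x]∣ r p x = ≤-trans (p⊆q⇒∣p∣≤∣q∣ split) (≤-trans (∣p∪q∣≤∣p∣+∣q∣ (r ∩ (p - x)) ⁅ x ⁆) size)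
  where
  split : r ∩ p ⊆ (r ∩ (p - x)) ∪ ⁅ x ⁆
  split {w} w∈r∩p with w ≟ᶠ x
  ... | yes refl = q⊆p∪q _ _ (x∈⁅x⁆ x)
  ... | no w≢x   = let (w∈r , w∈p) = x∈p∩q⁻ r p w∈r∩p in
                   p⊆p∪q _ (x∈p∩q⁺ (w∈r , x∈p∧x≢y⇒x∈p-y w∈p w≢x))
  size : ∣ r ∩ (p - x) ∣ + ∣ ⁅ x ⁆ ∣ ≤ suc ∣ r ∩ (p - x) ∣
  size = ≤-reflexive (trans (cong (∣ r ∩ (p - x) ∣ +_) (∣⁅x⁆∣≡1 x)) (+-comm _ 1))

x∈p─q⇒x∉q : {x : Fin m} (p q : Subset m) → x ∈ p ─ q → x ∉ q
x∈p─q⇒x∉q (inside ∷ p) (outside ∷ q) here         ()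
x∈p─q⇒x∉q (_ ∷ p)      (_ ∷ q)       (there x∈p─q) (there x∈q) = x∈p─q⇒x∉q p q x∈p─q x∈q

x∈p-y⇒x≢y : {x y : Fin m} (p : Subset m) → x ∈ p - y → x ≢ y
x∈p-y⇒x≢y {y = y} p x∈p-y = x∉⁅y⁆⇒x≢y (x∈p─q⇒x∉q p ⁅ y ⁆ x∈p-y)

x∉r⇒r∩p⊆r∩[p-x] : {r p : Subset m} {x : Fin m} → x ∉ r → r ∩ p ⊆ r ∩ (p - x)
x∉r⇒r∩p⊆r∩[p-x] {r = r} {p} x∉r w∈r∩p =
  let (w∈r , w∈p) = x∈p∩q⁻ r p w∈r∩p in
  x∈p∩q⁺ (w∈r , x∈p∧x≢y⇒x∈p-y w∈p λ { refl → x∉r w∈r })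

∩-monoʳ-⊆ : {r p q : Subset m} → p ⊆ q → r ∩ p ⊆ r ∩ q
∩-monoʳ-⊆ {r = r} {p} p⊆q w∈r∩p =
  let (w∈r , w∈p) = x∈p∩q⁻ r p w∈r∩p in x∈p∩q⁺ (w∈r , p⊆q w∈p)

∪-least : {p q r : Subset m} → p ⊆ r → q ⊆ r → p ∪ q ⊆ r
∪-least {p = p} {q} p⊆r q⊆r w∈p∪q with x∈p∪q⁻ p q w∈p∪q
... | inj₁ w∈p = p⊆r w∈p
... | inj₂ w∈q = q⊆r w∈q

p-x⊆r⇒p⊆r : {p r : Subset m} {x : Fin m} → p - x ⊆ r → x ∈ r → p ⊆ r
p-x⊆r⇒p⊆r {x = x} p-x⊆r x∈r {w} w∈p with w ≟ᶠ x
... | yes refl = x∈r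
... | no w≢x   = p-x⊆r (x∈p∧x≢y⇒x∈p-y w∈p w≢x)

p⊆r⇒p∪⁅x⁆⊆r : {p r : Subset m} {x : Fin m} → p ⊆ r → x ∈ r → p ∪ ⁅ x ⁆ ⊆ r
p⊆r⇒p∪⁅x⁆⊆r {r = r} {x} p⊆r x∈r =
  ∪-least p⊆r λ w∈⁅x⁆ → subst (_∈ r) (sym (x∈⁅y⁆⇒x≡y x w∈⁅x⁆)) x∈r

module Activation {n : ℕ} (G : Graph n) (τ : Fin n → ℕ) (S₀ : Subset n) where

  Active-step : ∀ ℓ → Active G τ S₀ ℓ ⊆ Active G τ S₀ (suc ℓ)
  Active-step ℓ = p⊆p∪q _

  seed⊆Active : ∀ ℓ → S₀ ⊆ Active G τ S₀ ℓ
  seed⊆Active zero    = id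
  seed⊆Active (suc ℓ) = Active-step ℓ ∘ seed⊆Active ℓ

  fire : ∀ ℓ {u} {X : Subset n} → X ⊆ Γ G u → X ⊆ Active G τ S₀ ℓ → τ u ≤ ∣ X ∣ →
         u ∈ Active G τ S₀ (suc ℓ)
  fire ℓ {u} {X} X⊆Γu X⊆Aℓ τu≤∣X∣ = q⊆p∪q _ _ (lookup⇒[]= u _ fires)
    where
    enough : τ u ≤ ∣ Γ G u ∩ Active G τ S₀ ℓ ∣
    enough = ≤-trans τu≤∣X∣ (p⊆q⇒∣p∣≤∣q∣ λ w∈X → x∈p∩q⁺ (X⊆Γu w∈X , X⊆Aℓ w∈X))
    reached : Fin n → Bool
    reached w = does (τ w ≤? ∣ Γ G w ∩ Active G τ S₀ ℓ ∣)
    fires : lookup (tabulate reached) u ≡ true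
    fires = trans (lookup∘tabulate reached u) (dec-true (τ u ≤? _) enough)

module Bookkeeping {n : ℕ} (G : Graph n) where

  record Faithful (st : State n) : Set where
    field
      N⊆Γ : ∀ {u} → u ∈ U st → N st u ⊆ Γ G u
      Γ⊆N : ∀ {u w} → u ∈ U st → w ∈ U st → w ∈ Γ G u → w ∈ N st u
      δ≤  : ∀ {u} → u ∈ U st → δ st u ≤ ∣ Γ G u ∩ U st ∣
  open Faithful public

  initial-faithful : (t : Fin n → ℕ) → Faithful (initState G t)
  initial-faithful t = record
    { N⊆Γ = λ _ → id
    ; Γ⊆N = λ _ _ w∈Γu → w∈Γu
    ; δ≤  = λ {u} _ → p⊆q⇒∣p∣≤∣q∣ {p = Γ G u} {q = Γ G u ∩ ⊤} λ w∈Γu → x∈p∩q⁺ (w∈Γu , ∈⊤)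
    }

  pruned⊆ : (b : Bool) (p : Subset n) (x : Fin n) → (if b then p - x else p) ⊆ p
  pruned⊆ true  p x = p─q⊆p p ⁅ x ⁆
  pruned⊆ false p x = id

  ∈pruned : (b : Bool) {p : Subset n} {w x : Fin n} → w ∈ p → w ≢ x →
            w ∈ (if b then p - x else p)
  ∈pruned true  w∈p w≢x = x∈p∧x≢y⇒x∈p-y w∈p w≢x
  ∈pruned false w∈p w≢x = w∈p

  module Removal {st : State n} {v : Fin n} (v∈U : v ∈ U st) (F : Faithful st) where

    stays : ∀ {u} → u ∈ U st - v → u ∈ U st
    stays = p─q⊆p (U st) ⁅ v ⁆

    adjacent : ∀ {u} → u ∈ N st v → v ∈ Γ G u
    adjacent u∈Nv = Graph.sym G (N⊆Γ F v∈U u∈Nv)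

    non-adjacent : ∀ {u} → u ∈ U st - v → ¬ u ∈ N st v → v ∉ Γ G u
    non-adjacent u∈U-v u∉Nv v∈Γu = u∉Nv (Γ⊆N F v∈U (stays u∈U-v) (Graph.sym G v∈Γu))

    δ-update : ∀ {u} → u ∈ U st - v →
               (if does (u ∈? N st v) then δ st u ∸ 1 else δ st u) ≤ ∣ Γ G u ∩ (U st - v) ∣
    δ-update {u} u∈U-v with u ∈? N st v
    ... | yes _ = ≤-trans (∸-monoˡ-≤ 1 (δ≤ F (stays u∈U-v)))
                          (∸-monoˡ-≤ 1 (∣r∩p∣≤1+∣r∩[p-x]∣ (Γ G u) (U st) v))
    ... | no u∉Nv = ≤-trans (δ≤ F (stays u∈U-v))
                            (p⊆q⇒∣p∣≤∣q∣ (x∉r⇒r∩p⊆r∩[p-x] (non-adjacent u∈U-v u∉Nv)))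

    finish-faithful : (k' : Fin n → ℕ) (S' : Subset n) → Faithful (finish st v k' S')
    finish-faithful k' S' = record
      { N⊆Γ = λ {u} u∈U-v → N⊆Γ F (stays u∈U-v) ∘ pruned⊆ (does (u ∈? N st v)) (N st u) v
      ; Γ⊆N = λ {u} u∈U-v w∈U-v w∈Γu →
                ∈pruned (does (u ∈? N st v)) (Γ⊆N F (stays u∈U-v) (stays w∈U-v) w∈Γu)
                        (x∈p-y⇒x≢y (U st) w∈U-v)
      ; δ≤  = δ-update
      }

module Thresholds {n : ℕ} (G : Graph n) (t : Fin n → ℕ) where
  open Bookkeeping G

  -- The counters of the vertices in U, relative to the set D of settled vertices
  -- (those removed in Case 1 or Case 2): each settled neighbour accounts for
  -- one unit of threshold that k no longer records.
  record Invariant (st : State n) (D : Subset n) : Set where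
    field
      faithful : Faithful st
      t≤k+∣Γ∩D∣ : ∀ {u} → u ∈ U st → t u ≤ k st u + ∣ Γ G u ∩ D ∣
      U∩D≡∅   : ∀ {w} → w ∈ U st → w ∉ D
  open Invariant public

  initial-invariant : Invariant (initState G t) ⊥
  initial-invariant = record
    { faithful  = initial-faithful t
    ; t≤k+∣Γ∩D∣ = λ {u} _ → m≤m+n (t u) _
    ; U∩D≡∅     = λ _ → ∉⊥
    }

  settle : ∀ {st D v} → v ∈ U st → Invariant st D → (S' : Subset n) →
           Invariant (finish st v (λ u → if does (u ∈? N st v) then k st u ∸ 1 else k st u) S')
                     (D ∪ ⁅ v ⁆)
  settle {st} {D} {v} v∈U I S' = record
    { faithful  = finish-faithful _ S'
    ; t≤k+∣Γ∩D∣ = k-update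
    ; U∩D≡∅     = disjoint
    }
    where
    open Removal v∈U (faithful I)

    gained : ∀ {u} → v ∈ Γ G u → Γ G u ∩ D ⊂ Γ G u ∩ (D ∪ ⁅ v ⁆)
    gained v∈Γu = ∩-monoʳ-⊆ (p⊆p∪q ⁅ v ⁆)
                , v , x∈p∩q⁺ (v∈Γu , q⊆p∪q D ⁅ v ⁆ (x∈⁅x⁆ v))
                , λ v∈Γu∩D → U∩D≡∅ I v∈U (p∩q⊆q (Γ G _) D v∈Γu∩D)

    k-update : ∀ {u} → u ∈ U st - v →
               t u ≤ (if does (u ∈? N st v) then k st u ∸ 1 else k st u) + ∣ Γ G u ∩ (D ∪ ⁅ v ⁆) ∣
    k-update {u} u∈U-v with u ∈? N st v
    ... | yes u∈Nv = begin
      t u                                    ≤⟨ t≤k+∣Γ∩D∣ I (stays u∈U-v) ⟩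
      k st u + ∣ Γ G u ∩ D ∣                 ≤⟨ +-monoˡ-≤ _ (m≤n+m∸n (k st u) 1) ⟩
      suc (k st u ∸ 1) + ∣ Γ G u ∩ D ∣       ≡⟨ +-suc (k st u ∸ 1) _ ⟨
      (k st u ∸ 1) + suc ∣ Γ G u ∩ D ∣       ≤⟨ +-monoʳ-≤ _ (p⊂q⇒∣p∣<∣q∣ (gained (adjacent u∈Nv))) ⟩
      (k st u ∸ 1) + ∣ Γ G u ∩ (D ∪ ⁅ v ⁆) ∣ ∎
      where open ≤-Reasoning
    ... | no _ = ≤-trans (t≤k+∣Γ∩D∣ I (stays u∈U-v))
                         (+-monoʳ-≤ (k st u) (p⊆q⇒∣p∣≤∣q∣ (∩-monoʳ-⊆ {r = Γ G u} (p⊆p∪q ⁅ v ⁆))))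

    disjoint : ∀ {w} → w ∈ U st - v → w ∉ D ∪ ⁅ v ⁆
    disjoint w∈U-v w∈D∪v with x∈p∪q⁻ D ⁅ v ⁆ w∈D∪v
    ... | inj₁ w∈D   = U∩D≡∅ I (stays w∈U-v) w∈D
    ... | inj₂ w∈⁅v⁆ = x∈p-y⇒x≢y (U st) w∈U-v (x∈⁅y⁆⇒x≡y v w∈⁅v⁆)

  defer : ∀ {st D v} → v ∈ U st → Invariant st D → (S' : Subset n) →
          Invariant (finish st v (k st) S') D
  defer {st} v∈U I S' = record
    { faithful  = finish-faithful (k st) S'
    ; t≤k+∣Γ∩D∣ = t≤k+∣Γ∩D∣ I ∘ stays
    ; U∩D≡∅     = U∩D≡∅ I ∘ stays
    }
    where open Removal v∈U (faithful I)

  deferred-threshold : ∀ {st D v} → v ∈ U st → Invariant st D → ¬ (δ st v < k st v) →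
                       t v ≤ ∣ (Γ G v ∩ U st) ∪ (Γ G v ∩ D) ∣
  deferred-threshold {st} {D} {v} v∈U I δ≮k = begin
    t v                                   ≤⟨ t≤k+∣Γ∩D∣ I v∈U ⟩
    k st v + ∣ Γ G v ∩ D ∣                ≤⟨ +-monoˡ-≤ _ (≤-trans (≮⇒≥ δ≮k) (δ≤ (faithful I) v∈U)) ⟩
    ∣ Γ G v ∩ U st ∣ + ∣ Γ G v ∩ D ∣      ≡⟨ disjoint⇒∣p∪q∣≡∣p∣+∣q∣ _ _ apart ⟨
    ∣ (Γ G v ∩ U st) ∪ (Γ G v ∩ D) ∣      ∎
    where
    open ≤-Reasoning
    apart : Empty ((Γ G v ∩ U st) ∩ (Γ G v ∩ D))
    apart (w , w∈both) =
      let (w∈Γ∩U , w∈Γ∩D) = x∈p∩q⁻ (Γ G v ∩ U st) (Γ G v ∩ D) w∈both in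
      U∩D≡∅ I (p∩q⊆q (Γ G v) (U st) w∈Γ∩U) (p∩q⊆q (Γ G v) D w∈Γ∩D)

module Backward {n : ℕ} (G : Graph n) (t : Fin n → ℕ) (out : Subset n) where
  open Thresholds G t
  open Activation G t out

  S⊆output : ∀ {st} → Run st out → S st ⊆ out
  S⊆output (done _)                      = id
  S⊆output (step (case1 _ _ _) run)       = S⊆output run
  S⊆output (step (case2 v _ _ _) run)     = S⊆output run ∘ p⊆p∪q ⁅ v ⁆
  S⊆output (step (case3 _ _ _ _ _) run)   = S⊆output run

  reattach : ∀ {P D : Subset n} {v} →
             (∃ λ ℓ → P - v ⊆ Active G t out ℓ × D ∪ ⁅ v ⁆ ⊆ Active G t out ℓ) →
             ∃ λ ℓ → P ⊆ Active G t out ℓ × D ⊆ Active G t out ℓ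
  reattach {D = D} {v} (ℓ , P-v⊆ , D∪v⊆) =
    ℓ , p-x⊆r⇒p⊆r P-v⊆ (D∪v⊆ (q⊆p∪q D ⁅ v ⁆ (x∈⁅x⁆ v))) , D∪v⊆ ∘ p⊆p∪q ⁅ v ⁆

  cover : ∀ {st D} ℓ₀ → Run st out → Invariant st D → D ⊆ Active G t out ℓ₀ →
          ∃ λ ℓ → U st ⊆ Active G t out ℓ × D ⊆ Active G t out ℓ
  cover ℓ₀ (done U≡⊥) I D⊆ = ℓ₀ , subst (_⊆ _) (sym U≡⊥) ⊥⊆ , D⊆
  cover {st} {D} ℓ₀ (step (case1 v v∈U kv≡0) run) I D⊆ =
    reattach (cover (suc ℓ₀) run (settle v∈U I (S st))
                    (p⊆r⇒p∪⁅x⁆⊆r (Active-step ℓ₀ ∘ D⊆) v-active))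
    where
    -- k(v) = 0: the settled neighbours of v already meet its threshold.
    threshold : t v ≤ ∣ Γ G v ∩ D ∣
    threshold = subst (λ kv → t v ≤ kv + ∣ Γ G v ∩ D ∣) kv≡0 (t≤k+∣Γ∩D∣ I v∈U)
    v-active : v ∈ Active G t out (suc ℓ₀)
    v-active = fire ℓ₀ (p∩q⊆p (Γ G v) D) (D⊆ ∘ p∩q⊆q (Γ G v) D) threshold
  cover {st} ℓ₀ (step (case2 v v∈U _ _) run) I D⊆ =
    reattach (cover ℓ₀ run (settle v∈U I (S st ∪ ⁅ v ⁆)) (p⊆r⇒p∪⁅x⁆⊆r D⊆ v-active))
    where
    -- v enters S, hence the output, which is active in every round.
    v-active : v ∈ Active G t out ℓ₀
    v-active = seed⊆Active ℓ₀ (S⊆output run (q⊆p∪q (S st) ⁅ v ⁆ (x∈⁅x⁆ v)))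
  cover {st} {D} ℓ₀ (step (case3 v v∈U _ case2-fails _) run) I D⊆
    with cover ℓ₀ run (defer v∈U I (S st)) D⊆
  ... | ℓ , U-v⊆ , D⊆′ =
    suc ℓ , p-x⊆r⇒p⊆r (Active-step ℓ ∘ U-v⊆) v-active , Active-step ℓ ∘ D⊆′
    where
    -- The neighbours of v in U are, v itself excluded, in U - v.
    neighbours⊆ : (Γ G v ∩ U st) ∪ (Γ G v ∩ D) ⊆ Active G t out ℓ
    neighbours⊆ = ∪-least (U-v⊆ ∘ p∩q⊆q (Γ G v) (U st - v) ∘ x∉r⇒r∩p⊆r∩[p-x] (Graph.irrefl G))
                          (D⊆′ ∘ p∩q⊆q (Γ G v) D)
    v-active : v ∈ Active G t out (suc ℓ)
    v-active = fire ℓ (∪-least (p∩q⊆p (Γ G v) (U st)) (p∩q⊆p (Γ G v) D)) neighbours⊆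
                    (deferred-threshold v∈U I (case2-fails v v∈U))

theorem1 : ∀ {n} (G : Graph n) (t : Fin n → ℕ) (S : Subset n) →
           Run (initState G t) S → IsTargetSet G t S
theorem1 G t S run with Backward.cover G t S 0 run (Thresholds.initial-invariant G t) ⊥⊆
... | ℓ , V⊆Active , _ = ℓ , ⊆-antisym ⊆⊤ V⊆Active
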